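{- Let $X$ be a set of $n$ cards and $a,b,c$ positive integers with $a+b+c=n$ and $a-c=2$. Suppose Alice's $(a,b,c)$-strategy is equitable, informative for Bob, and perfectly $1$-secure against Cathy. Then $a=3$ and hence $c=1$.
   Context: An $(a,b,c)$-deal is a uniformly random partition of $X$ into Alice's hand $H_A$ ($a$ cards), Bob's hand $H_B$ ($b$ cards) and Cathy's hand $H_C$ ($c$ cards). An announcement is a set of $a$-subsets of $X$. An $(a,b,c)$-strategy consists of announcements $\mathcal{A}_1,\dots,\mathcal{A}_m$ covering all $a$-subsets of $X$ together with, for each $H_A$, a probability distribution $p_{H_A}$ with positive values on $g(H_A)=\{i : H_A\in\mathcal{A}_i\}$; Alice broadcasts an index $i$ chosen according to $p_{H_A}$. It is equitable if there is $\gamma$ with $|g(H_A)|=\gamma$ for all $H_A$ and every $p_{H_A}$ uniform. For $H\subseteq X$, $\mathcal{P}(H,i)=\{H_A\in\mathcal{A}_i : H_A\cap H=\emptyset\}$. Informative for Bob: $|\mathcal{P}(H_B,i)|\le 1$ for every $b$-subset $H_B$ and every $i$. Perfectly $1$-secure against Cathy: for every $i$, every $c$-subset $H_C$ with $\mathcal{P}(H_C,i)\neq\emptyset$ and every $x\in X\setminus H_C$, $\Pr[x\in H_A\mid i,H_C]=a/(a+b)$, probability over the deal and Alice's choice. -}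

module Defs where

open import Data.Bool using (Bool; true; false; _∧_; not; if_then_else_)
open import Data.Nat using (ℕ; zero; suc; _≡ᵇ_)
open import Data.Fin using (Fin)
open import Data.Fin.Subset using (Subset; ∣_∣)
open import Data.Vec using (Vec; []; _∷_; lookup)
open import Data.List using (List; []; _∷_; [_]; map; _++_; filter; length; concatMap; foldr; allFin)
open import Data.Product using (_×_; _,_; ∃; proj₁; proj₂)
open import Data.Integer using (+_)
open import Data.Rational using (ℚ; 0ℚ; 1ℚ; _/_; _+_; _*_; _<_)
open import Relation.Binary.PropositionalEquality using (_≡_)
open import Relation.Nullary.Decidable using (does)
open import Data.Bool using (_≟_)
import Data.Nat
open import Relation.Nullary using (¬_)

allSubsets : (n : ℕ) → List (Subset n)
allSubsets zero = [ [] ]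
allSubsets (suc n) = map (true ∷_) (allSubsets n) ++ map (false ∷_) (allSubsets n)

disjointᵇ : {n : ℕ} → Subset n → Subset n → Bool
disjointᵇ [] [] = true
disjointᵇ (x ∷ xs) (y ∷ ys) = not (x ∧ y) ∧ disjointᵇ xs ys

coversᵇ : {n : ℕ} → Subset n → Subset n → Subset n → Bool
coversᵇ [] [] [] = true
coversᵇ (x ∷ xs) (y ∷ ys) (z ∷ zs) =
  (if x then true else (if y then true else z)) ∧ coversᵇ xs ys zs

eqSubᵇ : {n : ℕ} → Subset n → Subset n → Bool
eqSubᵇ [] [] = true
eqSubᵇ (x ∷ xs) (y ∷ ys) = does (x ≟ y) ∧ eqSubᵇ xs ys

sizeᵇ : {n : ℕ} → Subset n → ℕ → Bool
sizeᵇ s k = ∣ s ∣ ≡ᵇ k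

ℚsum : List ℚ → ℚ
ℚsum = foldr _+_ 0ℚ

natℚ : ℕ → ℚ
natℚ k = (+ k) / 1

-- An (a,b,c)-strategy on X = Fin n with m announcements A_1..A_m.
-- ann i H = true  iff  H ∈ A_i ; p H i = p_H(i).
record Strategy (n a m : ℕ) : Set where
  field
    ann      : Fin m → Subset n → Bool
    ann-size : ∀ i H → ann i H ≡ true → ∣ H ∣ ≡ a
    covers   : ∀ H → ∣ H ∣ ≡ a → ∃ λ i → ann i H ≡ true
    p        : Subset n → Fin m → ℚ
    p-pos    : ∀ H → ∣ H ∣ ≡ a → ∀ i → ann i H ≡ true → 0ℚ < p H i
    p-zero   : ∀ H → ∣ H ∣ ≡ a → ∀ i → ann i H ≡ false → p H i ≡ 0ℚ
    p-sum    : ∀ H → ∣ H ∣ ≡ a → ℚsum (map (p H) (allFin m)) ≡ 1ℚ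

module _ {n a m : ℕ} (S : Strategy n a m) where
  open Strategy S

  g : Subset n → List (Fin m)
  g H = filter (λ i → ann i H ≟ true) (allFin m)

  Equitable : Set
  Equitable = ∃ λ γ → ∀ H → ∣ H ∣ ≡ a →
    (length (g H) ≡ γ) ×
    (∀ i j → ann i H ≡ true → ann j H ≡ true → p H i ≡ p H j)

  𝒫 : Subset n → Fin m → List (Subset n)
  𝒫 H i = filter (λ HA → (ann i HA ∧ disjointᵇ HA H) ≟ true) (allSubsets n)

  InformativeForBob : (b : ℕ) → Set
  InformativeForBob b = ∀ (HB : Subset n) → ∣ HB ∣ ≡ b → ∀ i → length (𝒫 HB i) Data.Nat.≤ 1

  deals : (b c : ℕ) → List (Subset n × Subset n × Subset n)
  deals b c =
    filter (λ { (HA , HB , HC) →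
             (sizeᵇ HA a ∧ sizeᵇ HB b ∧ sizeᵇ HC c ∧
              disjointᵇ HA HB ∧ disjointᵇ HA HC ∧ disjointᵇ HB HC ∧
              coversᵇ HA HB HC) ≟ true })
      (concatMap (λ HA → concatMap (λ HB → map (λ HC → HA , HB , HC) (allSubsets n))
                                    (allSubsets n)) (allSubsets n))

  -- Unnormalised joint weight of the event
  --   "Alice announces i, Cathy holds HC, and E(H_A) holds"
  -- = N · Pr[...], where N = number of deals (each deal has probability 1/N,
  -- and given the deal Alice announces i with probability p_{H_A}(i)).
  weight : (b c : ℕ) → Fin m → Subset n → (Subset n → Bool) → ℚ
  weight b c i HC E =
    ℚsum (map (λ { (HA , HB , HC') →
                   if eqSubᵇ HC' HC ∧ E HA then p HA i else 0ℚ })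
              (deals b c))

  -- perfectly 1-secure against Cathy:
  -- Pr[x ∈ H_A | i, H_C] = a/(a+b), written as
  -- Pr[x ∈ H_A ∧ i ∧ H_C] · (a+b) = a · Pr[i ∧ H_C]  (the common factor 1/N cancels)
  Perfectly1Secure : (b c : ℕ) → Set
  Perfectly1Secure b c =
    ∀ (i : Fin m) (HC : Subset n) → ∣ HC ∣ ≡ c → ¬ (𝒫 HC i ≡ []) →
    ∀ (x : Fin n) → lookup HC x ≡ false →
    natℚ (a Data.Nat.+ b) * weight b c i HC (λ HA → lookup HA x)
      ≡ natℚ a * weight b c i HC (λ _ → true)

module Submission where

-- Suppose c ≥ 2, so a = c + 2 ≥ 4, and fix an announcement 𝒜 containing a hand B.
-- Informativeness makes 𝒜 linear: two of its hands sharing two cards miss at least b cards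
-- together, and a hand of Bob among those would not tell them apart. Equitability makes all
-- positive p_H(i) equal, so perfect security says that for every c-set C the number of hands
-- of 𝒜 avoiding C and containing x is the same for all x ∉ C. Fix a (c − 2)-set D disjoint
-- from B and let r₁, r₂, r₃ count the hands avoiding D through one, two, three given cards.
-- For C = D ∪ {p, q}, inclusion–exclusion turns security into: r₁ x + r₃ x p q − r₂ x p − r₂ x q
-- does not depend on x. Evaluating this at cards of B and outside B ∪ D, where linearity
-- pins down most r₂ and r₃, gives r₁ o + 1 = r₁ b for o ∉ B ∪ D and b ∈ B, and shows that no
-- hand avoiding D contains two cards outside B ∪ D or one of them and one of B; with three
-- cards outside B ∪ D the same relation then gives r₁ o = r₁ b.

open import Defs
open import Data.Bool using (Bool; true; false; _∧_; _∨_; not; if_then_else_)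
import Data.Bool as Bool
import Data.Bool.Properties as Bool
open import Data.Empty using (⊥; ⊥-elim)
open import Level using (0ℓ)
open import Data.Fin using (Fin; zero; suc)
open import Data.Fin.Subset using (Subset; ∣_∣; _∪_; _∩_; ∁; ⁅_⁆; ⊤)
  renaming (⊥ to ∅)
open import Data.Fin.Subset.Properties using (∣⊤∣≡n; ∣⊥∣≡0; ∣⁅x⁆∣≡1; ∣p∣≤∣x∷p∣)
import Data.Integer as ℤ
import Data.Integer.Properties as ℤ
open import Data.List using (List; []; _∷_; map; _++_; filter; length; concatMap; allFin)
import Data.List.Properties as List
open import Data.List.Membership.Propositional using (_∈_)
open import Data.List.Membership.Propositional.Properties using (∈-map⁺; ∈-++⁺ˡ; ∈-++⁺ʳ)
open import Data.List.Relation.Unary.All using (All; []; _∷_)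
open import Data.List.Relation.Unary.Any using (here; there)
open import Data.Nat using (ℕ; zero; suc; _+_; _*_; _≤_; _<_; _>_; z≤n; s≤s; >-nonZero)
open import Data.Nat.Properties
open import Data.Nat.Coprimality as Coprime using (1-coprimeTo)
open import Data.Nat.Tactic.RingSolver using (solve-∀)
open import Data.Product using (_×_; _,_; ∃-syntax; Σ; proj₁; proj₂)
open import Data.Rational as ℚ using (ℚ; 0ℚ; 1ℚ; mkℚ)
import Data.Rational.Properties as ℚ
open import Data.Vec using ([]; _∷_; lookup; _[_]≔_)
open import Data.Vec.Properties using (lookup-map; lookup-zipWith; lookup-replicate; ≡-dec)
open import Function using (case_of_; _∘_)
open import Function.Bundles using (Equivalence)
open import Relation.Binary.PropositionalEquality
open import Relation.Nullary using (¬_; yes; no; does)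
open import Relation.Unary using (Pred; Decidable)

𝟙 : Bool → ℕ
𝟙 true  = 1
𝟙 false = 0

∧-true⁻ : ∀ {x y} → x ∧ y ≡ true → x ≡ true × y ≡ true
∧-true⁻ {true} {true} _ = refl , refl

not-∨-true⁻ : ∀ {x y} → not (x ∨ y) ≡ true → x ≡ false × y ≡ false
not-∨-true⁻ {false} {false} _ = refl , refl

Bool-ext : ∀ {x y : Bool} → (x ≡ true → y ≡ true) → (y ≡ true → x ≡ true) → x ≡ y
Bool-ext {true}  {true}  _ _ = refl
Bool-ext {true}  {false} f _ = sym (f refl)
Bool-ext {false} {true}  _ g = g refl
Bool-ext {false} {false} _ _ = refl

does-≟-true : ∀ x → does (x Bool.≟ true) ≡ x
does-≟-true true  = refl
does-≟-true false = refl

when : Bool → ℚ → ℚ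
when b q = if b then q else 0ℚ

when-∧ : ∀ x y q → when (x ∧ y) q ≡ when x (when y q)
when-∧ true  y q = refl
when-∧ false y q = refl

when-swap : ∀ x y q → when x (when y q) ≡ when y (when x q)
when-swap true  true  q = refl
when-swap true  false q = refl
when-swap false true  q = refl
when-swap false false q = refl

when-nested : ∀ x y z q → when y (when z (when x q)) ≡ when (x ∧ (y ∧ z)) q
when-nested true  true  true  q = refl
when-nested true  true  false q = refl
when-nested true  false z     q = refl
when-nested false true  true  q = refl
when-nested false true  false q = refl
when-nested false false z     q = refl

count : {A : Set} → (A → Bool) → List A → ℕ
count f []       = 0
count f (x ∷ xs) = 𝟙 (f x) + count f xs

module _ {A : Set} where

  length-filter-≟ : (f : A → Bool) (xs : List A) →
                    length (filter (λ x → f x Bool.≟ true) xs) ≡ count f xs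
  length-filter-≟ f []       = refl
  length-filter-≟ f (x ∷ xs) with f x
  ... | true  = cong suc (length-filter-≟ f xs)
  ... | false = length-filter-≟ f xs

  count-mono : {f g : A → Bool} → (∀ x → f x ≡ true → g x ≡ true) →
               ∀ xs → count f xs ≤ count g xs
  count-mono     h []       = z≤n
  count-mono {f} h (x ∷ xs) with f x in fx
  ... | false = ≤-trans (count-mono h xs) (m≤n+m _ _)
  ... | true rewrite h x fx = s≤s (count-mono h xs)

  count-cong : {f g : A → Bool} → (∀ x → f x ≡ g x) → ∀ xs → count f xs ≡ count g xs
  count-cong h xs = ≤-antisym (count-mono (λ x e → trans (sym (h x)) e) xs)
                              (count-mono (λ x e → trans (h x) e) xs)

  count-≡0 : {f : A → Bool} → (∀ x → f x ≢ true) → ∀ xs → count f xs ≡ 0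
  count-≡0     h []       = refl
  count-≡0 {f} h (x ∷ xs) with f x in fx
  ... | true  = ⊥-elim (h x fx)
  ... | false = count-≡0 h xs

  count-witness : {f : A → Bool} → ∀ xs → 0 < count f xs → ∃[ x ] f x ≡ true
  count-witness {f} (x ∷ xs) h with f x in fx
  ... | true  = x , fx
  ... | false = count-witness xs h

  count-≥1 : {f : A → Bool} {x : A} {xs : List A} → x ∈ xs → f x ≡ true → 1 ≤ count f xs
  count-≥1 {f} {xs = y ∷ ys} (here refl) fx rewrite fx = s≤s z≤n
  count-≥1 {f} {xs = y ∷ ys} (there x∈ys) fx =
    ≤-trans (count-≥1 x∈ys fx) (m≤n+m _ (𝟙 (f y)))

  count-≥2 : {f : A → Bool} {x y : A} {xs : List A} → x ∈ xs → y ∈ xs → x ≢ y →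
             f x ≡ true → f y ≡ true → 2 ≤ count f xs
  count-≥2 (here refl) (here refl)  x≢y _  _  = ⊥-elim (x≢y refl)
  count-≥2 (here refl) (there y∈xs) _   fx fy rewrite fx = s≤s (count-≥1 y∈xs fy)
  count-≥2 (there x∈xs) (here refl) _   fx fy rewrite fy = s≤s (count-≥1 x∈xs fx)
  count-≥2 {f} {xs = z ∷ zs} (there x∈zs) (there y∈zs) x≢y fx fy =
    ≤-trans (count-≥2 x∈zs y∈zs x≢y fx fy) (m≤n+m _ (𝟙 (f z)))

  count-++ : (f : A → Bool) (xs ys : List A) → count f (xs ++ ys) ≡ count f xs + count f ys
  count-++ f []       ys = refl
  count-++ f (x ∷ xs) ys = trans (cong (𝟙 (f x) +_) (count-++ f xs ys)) (sym (+-assoc (𝟙 (f x)) _ _))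

  count-map : {B : Set} (f : B → Bool) (g : A → B) (xs : List A) →
              count f (map g xs) ≡ count (λ x → f (g x)) xs
  count-map f g []       = refl
  count-map f g (x ∷ xs) = cong (𝟙 (f (g x)) +_) (count-map f g xs)

  count-linear : {f g h k l : A → Bool} →
    (∀ x → 𝟙 (f x) + 𝟙 (g x) + 𝟙 (h x) ≡ 𝟙 (k x) + 𝟙 (l x)) →
    ∀ xs → count f xs + count g xs + count h xs ≡ count k xs + count l xs
  count-linear e [] = refl
  count-linear {f} {g} {h} {k} {l} e (x ∷ xs) = begin
    𝟙 (f x) + count f xs + (𝟙 (g x) + count g xs) + (𝟙 (h x) + count h xs)
      ≡⟨ regroup₃ (𝟙 (f x)) (𝟙 (g x)) (𝟙 (h x)) (count f xs) (count g xs) (count h xs) ⟩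
    𝟙 (f x) + 𝟙 (g x) + 𝟙 (h x) + (count f xs + count g xs + count h xs)
      ≡⟨ cong₂ _+_ (e x) (count-linear e xs) ⟩
    𝟙 (k x) + 𝟙 (l x) + (count k xs + count l xs)
      ≡⟨ regroup₂ (𝟙 (k x)) (𝟙 (l x)) (count k xs) (count l xs) ⟩
    𝟙 (k x) + count k xs + (𝟙 (l x) + count l xs)
      ∎
    where
    open ≡-Reasoning
    regroup₃ : ∀ a b c d e f → a + d + (b + e) + (c + f) ≡ a + b + c + (d + e + f)
    regroup₃ = solve-∀
    regroup₂ : ∀ a b c d → a + b + (c + d) ≡ a + c + (b + d)
    regroup₂ = solve-∀

natℚ-mkℚ : ∀ k → natℚ k ≡ mkℚ (ℤ.+ k) 0 (Coprime.sym (1-coprimeTo k))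
natℚ-mkℚ k = ℚ.normalize-coprime (Coprime.sym (1-coprimeTo k))

natℚ-+ : ∀ m n → natℚ (m + n) ≡ natℚ m ℚ.+ natℚ n
natℚ-+ m n = sym (trans (cong₂ ℚ._+_ (natℚ-mkℚ m) (natℚ-mkℚ n)) (cong (ℚ._/ 1) numerator))
  where
  numerator : ℤ.+ m ℤ.* ℤ.+ 1 ℤ.+ ℤ.+ n ℤ.* ℤ.+ 1 ≡ ℤ.+ (m + n)
  numerator = trans (cong₂ ℤ._+_ (ℤ.*-identityʳ (ℤ.+ m)) (ℤ.*-identityʳ (ℤ.+ n))) (sym (ℤ.pos-+ m n))

natℚ-* : ∀ m n → natℚ (m * n) ≡ natℚ m ℚ.* natℚ n
natℚ-* m n = sym (trans (cong₂ ℚ._*_ (natℚ-mkℚ m) (natℚ-mkℚ n)) (cong (ℚ._/ 1) (sym (ℤ.pos-* m n))))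

natℚ-injective : ∀ {m n} → natℚ m ≡ natℚ n → m ≡ n
natℚ-injective {m} {n} e =
  ℤ.+-injective (cong ℚ.↥_ (trans (sym (natℚ-mkℚ m)) (trans e (natℚ-mkℚ n))))

*-cancelʳ-invertible : ∀ {x y v} w → w ℚ.* v ≡ 1ℚ → x ℚ.* v ≡ y ℚ.* v → x ≡ y
*-cancelʳ-invertible {x} {y} {v} w wv≡1 xv≡yv = begin
  x                     ≡⟨ undo x ⟩
  x ℚ.* v ℚ.* w         ≡⟨ cong (ℚ._* w) xv≡yv ⟩
  y ℚ.* v ℚ.* w         ≡⟨ sym (undo y) ⟩
  y                     ∎
  where
  open ≡-Reasoning
  undo : ∀ z → z ≡ z ℚ.* v ℚ.* w
  undo z = sym (begin
    z ℚ.* v ℚ.* w     ≡⟨ ℚ.*-assoc z v w ⟩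
    z ℚ.* (v ℚ.* w)   ≡⟨ cong (z ℚ.*_) (trans (ℚ.*-comm v w) wv≡1) ⟩
    z ℚ.* 1ℚ          ≡⟨ ℚ.*-identityʳ z ⟩
    z                 ∎)

inverse-unique : ∀ w {x y} → w ℚ.* x ≡ 1ℚ → w ℚ.* y ≡ 1ℚ → x ≡ y
inverse-unique w {x} {y} wx≡1 wy≡1 =
  *-cancelʳ-invertible x (trans (ℚ.*-comm x w) wx≡1)
    (trans (ℚ.*-comm x w) (trans wx≡1 (trans (sym wy≡1) (ℚ.*-comm w y))))

ℚsum-++ : ∀ (xs ys : List ℚ) → ℚsum (xs ++ ys) ≡ ℚsum xs ℚ.+ ℚsum ys
ℚsum-++ []       ys = sym (ℚ.+-identityˡ _)
ℚsum-++ (x ∷ xs) ys = trans (cong (x ℚ.+_) (ℚsum-++ xs ys)) (sym (ℚ.+-assoc x _ _))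

module _ {A : Set} where

  ℚsum-cong : {f g : A → ℚ} → (∀ x → f x ≡ g x) → ∀ xs → ℚsum (map f xs) ≡ ℚsum (map g xs)
  ℚsum-cong e []       = refl
  ℚsum-cong e (x ∷ xs) = cong₂ ℚ._+_ (e x) (ℚsum-cong e xs)

  ℚsum-concatMap : {B : Set} (f : B → ℚ) (g : A → List B) → ∀ xs →
    ℚsum (map f (concatMap g xs)) ≡ ℚsum (map (λ x → ℚsum (map f (g x))) xs)
  ℚsum-concatMap f g []       = refl
  ℚsum-concatMap f g (x ∷ xs) = begin
    ℚsum (map f (g x ++ concatMap g xs))                  ≡⟨ cong ℚsum (List.map-++ f (g x) _) ⟩
    ℚsum (map f (g x) ++ map f (concatMap g xs))          ≡⟨ ℚsum-++ (map f (g x)) _ ⟩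
    ℚsum (map f (g x)) ℚ.+ ℚsum (map f (concatMap g xs))  ≡⟨ cong (ℚsum (map f (g x)) ℚ.+_) (ℚsum-concatMap f g xs) ⟩
    ℚsum (map f (g x)) ℚ.+ ℚsum (map (λ x → ℚsum (map f (g x))) xs) ∎
    where open ≡-Reasoning

  ℚsum-filter : {P : Pred A 0ℓ} (P? : Decidable P) (f : A → ℚ) → ∀ xs →
    ℚsum (map f (filter P? xs)) ≡ ℚsum (map (λ x → when (does (P? x)) (f x)) xs)
  ℚsum-filter P? f []       = refl
  ℚsum-filter P? f (x ∷ xs) with does (P? x)
  ... | true  = cong (f x ℚ.+_) (ℚsum-filter P? f xs)
  ... | false = trans (ℚsum-filter P? f xs) (sym (ℚ.+-identityˡ _))

  ℚsum-indicator : (f : A → Bool) (v : ℚ) → ∀ xs →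
    ℚsum (map (λ x → when (f x) v) xs) ≡ natℚ (count f xs) ℚ.* v
  ℚsum-indicator f v []       = sym (ℚ.*-zeroˡ v)
  ℚsum-indicator f v (x ∷ xs) with f x
  ... | false = trans (ℚ.+-identityˡ _) (ℚsum-indicator f v xs)
  ... | true  = begin
    v ℚ.+ ℚsum (map (λ x → when (f x) v) xs)     ≡⟨ cong (v ℚ.+_) (ℚsum-indicator f v xs) ⟩
    v ℚ.+ natℚ (count f xs) ℚ.* v               ≡⟨ cong (ℚ._+ natℚ (count f xs) ℚ.* v) (sym (ℚ.*-identityˡ v)) ⟩
    1ℚ ℚ.* v ℚ.+ natℚ (count f xs) ℚ.* v        ≡⟨ sym (ℚ.*-distribʳ-+ v 1ℚ (natℚ (count f xs))) ⟩
    (1ℚ ℚ.+ natℚ (count f xs)) ℚ.* v            ≡⟨ cong (ℚ._* v) (sym (natℚ-+ 1 (count f xs))) ⟩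
    natℚ (suc (count f xs)) ℚ.* v               ∎
    where open ≡-Reasoning

ℚsum-triples : {A B C : Set} (F : A × B × C → ℚ) (xs : List A) (ys : List B) (zs : List C) →
  ℚsum (map F (concatMap (λ x → concatMap (λ y → map (λ z → x , y , z) zs) ys) xs))
    ≡ ℚsum (map (λ x → ℚsum (map (λ y → ℚsum (map (λ z → F (x , y , z)) zs)) ys)) xs)
ℚsum-triples F xs ys zs =
  trans (ℚsum-concatMap F _ xs) (ℚsum-cong (λ x →
  trans (ℚsum-concatMap F _ ys) (ℚsum-cong (λ y →
  cong ℚsum (sym (List.map-∘ zs))) ys)) xs)

∣p∣+∣∁p∣≡n : ∀ {n} (p : Subset n) → ∣ p ∣ + ∣ ∁ p ∣ ≡ n
∣p∣+∣∁p∣≡n []          = refl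
∣p∣+∣∁p∣≡n (true ∷ p)  = cong suc (∣p∣+∣∁p∣≡n p)
∣p∣+∣∁p∣≡n (false ∷ p) = trans (+-suc ∣ p ∣ _) (cong suc (∣p∣+∣∁p∣≡n p))

∣p∪q∣+∣p∩q∣≡∣p∣+∣q∣ : ∀ {n} (p q : Subset n) → ∣ p ∪ q ∣ + ∣ p ∩ q ∣ ≡ ∣ p ∣ + ∣ q ∣
∣p∪q∣+∣p∩q∣≡∣p∣+∣q∣ []          []          = refl
∣p∪q∣+∣p∩q∣≡∣p∣+∣q∣ (true ∷ p)  (true ∷ q)  = cong suc (begin
  ∣ p ∪ q ∣ + suc ∣ p ∩ q ∣   ≡⟨ +-suc ∣ p ∪ q ∣ _ ⟩
  suc (∣ p ∪ q ∣ + ∣ p ∩ q ∣) ≡⟨ cong suc (∣p∪q∣+∣p∩q∣≡∣p∣+∣q∣ p q) ⟩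
  suc (∣ p ∣ + ∣ q ∣)         ≡⟨ +-suc ∣ p ∣ ∣ q ∣ ⟨
  ∣ p ∣ + suc ∣ q ∣           ∎)
  where open ≡-Reasoning
∣p∪q∣+∣p∩q∣≡∣p∣+∣q∣ (true ∷ p)  (false ∷ q) = cong suc (∣p∪q∣+∣p∩q∣≡∣p∣+∣q∣ p q)
∣p∪q∣+∣p∩q∣≡∣p∣+∣q∣ (false ∷ p) (true ∷ q)  =
  trans (cong suc (∣p∪q∣+∣p∩q∣≡∣p∣+∣q∣ p q)) (sym (+-suc ∣ p ∣ ∣ q ∣))
∣p∪q∣+∣p∩q∣≡∣p∣+∣q∣ (false ∷ p) (false ∷ q) = ∣p∪q∣+∣p∩q∣≡∣p∣+∣q∣ p q

∣p∣≡0 : ∀ {n} (p : Subset n) → (∀ x → lookup p x ≢ true) → ∣ p ∣ ≡ 0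
∣p∣≡0 []          _ = refl
∣p∣≡0 (true ∷ p)  h = ⊥-elim (h zero refl)
∣p∣≡0 (false ∷ p) h = ∣p∣≡0 p (λ x → h (suc x))

∣p∪q∣≡∣p∣+∣q∣ : ∀ {n} (p q : Subset n) → (∀ x → lookup p x ≡ true → lookup q x ≡ false) →
                ∣ p ∪ q ∣ ≡ ∣ p ∣ + ∣ q ∣
∣p∪q∣≡∣p∣+∣q∣ p q disjoint = begin
  ∣ p ∪ q ∣                ≡⟨ +-identityʳ _ ⟨
  ∣ p ∪ q ∣ + 0            ≡⟨ cong (∣ p ∪ q ∣ +_) (∣p∣≡0 (p ∩ q) empty) ⟨
  ∣ p ∪ q ∣ + ∣ p ∩ q ∣    ≡⟨ ∣p∪q∣+∣p∩q∣≡∣p∣+∣q∣ p q ⟩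
  ∣ p ∣ + ∣ q ∣            ∎
  where
  open ≡-Reasoning
  empty : ∀ x → lookup (p ∩ q) x ≢ true
  empty x e with ∧-true⁻ (trans (sym (lookup-zipWith _∧_ x p q)) e)
  ... | px , qx with () ← trans (sym (disjoint x px)) qx

1≤∣p∣ : ∀ {n} (p : Subset n) {x : Fin n} → lookup p x ≡ true → 1 ≤ ∣ p ∣
1≤∣p∣ (true ∷ p)  {zero}  _  = s≤s z≤n
1≤∣p∣ (b ∷ p)     {suc x} px = ≤-trans (1≤∣p∣ p px) (∣p∣≤∣x∷p∣ b p)

2≤∣p∣ : ∀ {n} (p : Subset n) {x y : Fin n} → x ≢ y → lookup p x ≡ true → lookup p y ≡ true → 2 ≤ ∣ p ∣
2≤∣p∣ (b ∷ p)    {zero}  {zero}  x≢y _  _  = ⊥-elim (x≢y refl)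
2≤∣p∣ (true ∷ p) {zero}  {suc y} _   _  py = s≤s (1≤∣p∣ p py)
2≤∣p∣ (true ∷ p) {suc x} {zero}  _   px _  = s≤s (1≤∣p∣ p px)
2≤∣p∣ (b ∷ p)    {suc x} {suc y} x≢y px py =
  ≤-trans (2≤∣p∣ p (λ x≡y → x≢y (cong suc x≡y)) px py) (∣p∣≤∣x∷p∣ b p)

select : ∀ {n} (p : Subset n) (k : ℕ) → k ≤ ∣ p ∣ →
         ∃[ q ] ∣ q ∣ ≡ k × (∀ x → lookup q x ≡ true → lookup p x ≡ true)
select {n} p zero _ = ∅ , ∣⊥∣≡0 n , λ x ∅x → case trans (sym (lookup-replicate x false)) ∅x of λ ()
select (true ∷ p) (suc k) (s≤s k≤∣p∣) with select p k k≤∣p∣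
... | q , ∣q∣≡k , q⊆p = true ∷ q , cong suc ∣q∣≡k , λ { zero _ → refl ; (suc x) → q⊆p x }
select (false ∷ p) (suc k) k<∣p∣ with select p (suc k) k<∣p∣
... | q , ∣q∣≡k , q⊆p = false ∷ q , ∣q∣≡k , λ { (suc x) → q⊆p x }

nonempty-witness : ∀ {n} (p : Subset n) → 0 < ∣ p ∣ → ∃[ x ] lookup p x ≡ true
nonempty-witness (true ∷ p)  _ = zero , refl
nonempty-witness (false ∷ p) h with nonempty-witness p h
... | x , px = suc x , px

∣p∣≤1+∣p[x]≔false∣ : ∀ {n} (p : Subset n) (x : Fin n) → ∣ p ∣ ≤ suc ∣ p [ x ]≔ false ∣
∣p∣≤1+∣p[x]≔false∣ (true ∷ p)  zero    = ≤-refl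
∣p∣≤1+∣p[x]≔false∣ (false ∷ p) zero    = n≤1+n _
∣p∣≤1+∣p[x]≔false∣ (true ∷ p)  (suc x) = s≤s (∣p∣≤1+∣p[x]≔false∣ p x)
∣p∣≤1+∣p[x]≔false∣ (false ∷ p) (suc x) = ∣p∣≤1+∣p[x]≔false∣ p x

lookup-[]≔false : ∀ {n} (p : Subset n) (x y : Fin n) → lookup (p [ x ]≔ false) y ≡ true →
                  lookup p y ≡ true × y ≢ x
lookup-[]≔false (b ∷ p) zero    (suc y) e = e , λ ()
lookup-[]≔false (b ∷ p) (suc x) zero    e = e , λ ()
lookup-[]≔false (b ∷ p) (suc x) (suc y) e with lookup-[]≔false p x y e
... | py , y≢x = py , λ { refl → y≢x refl }

pick : ∀ {n} (p : Subset n) (ys : List (Fin n)) → length ys < ∣ p ∣ →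
       ∃[ x ] lookup p x ≡ true × All (x ≢_) ys
pick p []       h with nonempty-witness p h
... | x , px = x , px , []
pick p (y ∷ ys) h with pick (p [ y ]≔ false) ys (≤-pred (≤-trans h (∣p∣≤1+∣p[x]≔false∣ p y)))
... | x , px′ , x∉ys with lookup-[]≔false p y x px′
... | px , x≢y = x , px , x≢y ∷ x∉ys

lookup-⁅y⁆-x : ∀ {n} {x y : Fin n} → x ≢ y → lookup ⁅ y ⁆ x ≡ false
lookup-⁅y⁆-x {x = zero}  {zero}  x≢y = ⊥-elim (x≢y refl)
lookup-⁅y⁆-x {x = zero}  {suc y} _   = refl
lookup-⁅y⁆-x {x = suc x} {zero}  _   = lookup-replicate x false
lookup-⁅y⁆-x {x = suc x} {suc y} x≢y = lookup-⁅y⁆-x (λ x≡y → x≢y (cong suc x≡y))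

lookup-⁅y⁆⇒≡ : ∀ {n} {x y : Fin n} → lookup ⁅ y ⁆ x ≡ true → x ≡ y
lookup-⁅y⁆⇒≡ {x = zero}  {zero}  _ = refl
lookup-⁅y⁆⇒≡ {x = suc x} {zero}  e = case trans (sym (lookup-replicate x false)) e of λ ()
lookup-⁅y⁆⇒≡ {x = suc x} {suc y} e = cong suc (lookup-⁅y⁆⇒≡ e)

disjointᵇ⇒ : ∀ {n} (S T : Subset n) → disjointᵇ S T ≡ true →
             ∀ x → lookup S x ≡ true → lookup T x ≡ false
disjointᵇ⇒ (true  ∷ S) (false ∷ T) _ zero    _ = refl
disjointᵇ⇒ (true  ∷ S) (true  ∷ T) () zero
disjointᵇ⇒ (s ∷ S) (t ∷ T) d (suc x) with s | t | d
... | true  | false | d′ = disjointᵇ⇒ S T d′ x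
... | false | _     | d′ = disjointᵇ⇒ S T d′ x

⇒disjointᵇ : ∀ {n} (S T : Subset n) → (∀ x → lookup S x ≡ true → lookup T x ≡ false) →
             disjointᵇ S T ≡ true
⇒disjointᵇ []          []          _ = refl
⇒disjointᵇ (false ∷ S) (t ∷ T)     h = ⇒disjointᵇ S T (λ x → h (suc x))
⇒disjointᵇ (true ∷ S)  (false ∷ T) h = ⇒disjointᵇ S T (λ x → h (suc x))
⇒disjointᵇ (true ∷ S)  (true ∷ T)  h with () ← h zero refl

disjointᵇ-∅ : ∀ {n} (H : Subset n) → disjointᵇ H ∅ ≡ true
disjointᵇ-∅ []      = refl
disjointᵇ-∅ (true ∷ H)  = disjointᵇ-∅ H
disjointᵇ-∅ (false ∷ H) = disjointᵇ-∅ H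

disjointᵇ-⁅⁆ : ∀ {n} (H : Subset n) (x : Fin n) → disjointᵇ H ⁅ x ⁆ ≡ not (lookup H x)
disjointᵇ-⁅⁆ (true  ∷ H) zero    = refl
disjointᵇ-⁅⁆ (false ∷ H) zero    = disjointᵇ-∅ H
disjointᵇ-⁅⁆ (true  ∷ H) (suc x) = disjointᵇ-⁅⁆ H x
disjointᵇ-⁅⁆ (false ∷ H) (suc x) = disjointᵇ-⁅⁆ H x

disjointᵇ-∪ : ∀ {n} (H S T : Subset n) → disjointᵇ H (S ∪ T) ≡ disjointᵇ H S ∧ disjointᵇ H T
disjointᵇ-∪ []      []      []      = refl
disjointᵇ-∪ (h ∷ H) (s ∷ S) (t ∷ T) rewrite disjointᵇ-∪ H S T = heads h s t
  where
  heads : ∀ h s t {x y} → not (h ∧ (s ∨ t)) ∧ (x ∧ y) ≡ (not (h ∧ s) ∧ x) ∧ (not (h ∧ t) ∧ y)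
  heads false s     t     = refl
  heads true  true  t     = refl
  heads true  false true  {x} = sym (Bool.∧-zeroʳ x)
  heads true  false false = refl

sizeᵇ⇒ : ∀ {n} {s : Subset n} {k} → sizeᵇ s k ≡ true → ∣ s ∣ ≡ k
sizeᵇ⇒ {s = s} {k} e = ≡ᵇ⇒≡ ∣ s ∣ k (Equivalence.from Bool.T-≡ e)

⇒sizeᵇ : ∀ {n} {s : Subset n} {k} → ∣ s ∣ ≡ k → sizeᵇ s k ≡ true
⇒sizeᵇ {s = s} refl = Equivalence.to Bool.T-≡ (≡⇒≡ᵇ ∣ s ∣ ∣ s ∣ refl)

eqSubᵇ⇒≡ : ∀ {n} {S T : Subset n} → eqSubᵇ S T ≡ true → S ≡ T
eqSubᵇ⇒≡ {S = []}      {[]}      _ = refl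
eqSubᵇ⇒≡ {S = true ∷ S}  {true ∷ T}  e = cong (true ∷_) (eqSubᵇ⇒≡ e)
eqSubᵇ⇒≡ {S = false ∷ S} {false ∷ T} e = cong (false ∷_) (eqSubᵇ⇒≡ e)

eqSubᵇ-refl : ∀ {n} (S : Subset n) → eqSubᵇ S S ≡ true
eqSubᵇ-refl []          = refl
eqSubᵇ-refl (true ∷ S)  = eqSubᵇ-refl S
eqSubᵇ-refl (false ∷ S) = eqSubᵇ-refl S

∈-allSubsets : ∀ {n} (S : Subset n) → S ∈ allSubsets n
∈-allSubsets []                  = here refl
∈-allSubsets {suc n} (true ∷ S)  = ∈-++⁺ˡ (∈-map⁺ (true ∷_) (∈-allSubsets S))
∈-allSubsets {suc n} (false ∷ S) = ∈-++⁺ʳ (map (true ∷_) (allSubsets n)) (∈-map⁺ (false ∷_) (∈-allSubsets S))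

count-allSubsets-eqSubᵇ : ∀ {n} (T : Subset n) → count (λ S → eqSubᵇ S T) (allSubsets n) ≡ 1
count-allSubsets-eqSubᵇ []                  = refl
count-allSubsets-eqSubᵇ {suc n} (t ∷ T) = begin
  count (λ S → eqSubᵇ S (t ∷ T)) (map (true ∷_) L ++ map (false ∷_) L)
    ≡⟨ count-++ _ (map (true ∷_) L) _ ⟩
  count (λ S → eqSubᵇ S (t ∷ T)) (map (true ∷_) L) + count (λ S → eqSubᵇ S (t ∷ T)) (map (false ∷_) L)
    ≡⟨ cong₂ _+_ (count-map _ (true ∷_) L) (count-map _ (false ∷_) L) ⟩
  count (λ S → eqSubᵇ (true ∷ S) (t ∷ T)) L + count (λ S → eqSubᵇ (false ∷ S) (t ∷ T)) L
    ≡⟨ halves t ⟩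
  1 ∎
  where
  open ≡-Reasoning
  L : List (Subset n)
  L = allSubsets n
  none : ∀ {f : Subset n → Bool} → (∀ S → f S ≡ false) → count f L ≡ 0
  none h = count-≡0 (λ S e → case trans (sym (h S)) e of λ ()) L
  halves : ∀ t → count (λ S → eqSubᵇ (true ∷ S) (t ∷ T)) L + count (λ S → eqSubᵇ (false ∷ S) (t ∷ T)) L ≡ 1
  halves true  = cong₂ _+_ (count-allSubsets-eqSubᵇ T) (none (λ _ → refl))
  halves false = cong₂ _+_ (none (λ _ → refl)) (count-allSubsets-eqSubᵇ T)

ℚsum-point : ∀ {n} (T : Subset n) (g : Subset n → ℚ) →
             ℚsum (map (λ S → when (eqSubᵇ S T) (g S)) (allSubsets n)) ≡ g T
ℚsum-point {n} T g = begin
  ℚsum (map (λ S → when (eqSubᵇ S T) (g S)) L)     ≡⟨ ℚsum-cong at-T L ⟩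
  ℚsum (map (λ S → when (eqSubᵇ S T) (g T)) L)     ≡⟨ ℚsum-indicator (λ S → eqSubᵇ S T) (g T) L ⟩
  natℚ (count (λ S → eqSubᵇ S T) L) ℚ.* g T        ≡⟨ cong (λ k → natℚ k ℚ.* g T) (count-allSubsets-eqSubᵇ T) ⟩
  1ℚ ℚ.* g T                                       ≡⟨ ℚ.*-identityˡ (g T) ⟩
  g T                                              ∎
  where
  open ≡-Reasoning
  L : List (Subset n)
  L = allSubsets n
  at-T : ∀ S → when (eqSubᵇ S T) (g S) ≡ when (eqSubᵇ S T) (g T)
  at-T S with eqSubᵇ S T in e
  ... | true  = cong g (eqSubᵇ⇒≡ {S = S} e)
  ... | false = refl

-- Deals
bob-hand-unique : ∀ {n} (HA HB HC : Subset n) → disjointᵇ HA HB ≡ true → disjointᵇ HB HC ≡ true →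
                  coversᵇ HA HB HC ≡ true → HB ≡ ∁ (HA ∪ HC)
bob-hand-unique []           []           []           _  _  _  = refl
bob-hand-unique (true  ∷ HA) (false ∷ HB) (c ∷ HC)     d₁ d₂ cv = cong (false ∷_) (bob-hand-unique HA HB HC d₁ d₂ cv)
bob-hand-unique (false ∷ HA) (true ∷ HB)  (false ∷ HC) d₁ d₂ cv = cong (true ∷_)  (bob-hand-unique HA HB HC d₁ d₂ cv)
bob-hand-unique (false ∷ HA) (false ∷ HB) (true ∷ HC)  d₁ d₂ cv = cong (false ∷_) (bob-hand-unique HA HB HC d₁ d₂ cv)

complement-hand : ∀ {n} (HA HC : Subset n) → disjointᵇ HA HC ≡ true →
  disjointᵇ HA (∁ (HA ∪ HC)) ≡ true × disjointᵇ (∁ (HA ∪ HC)) HC ≡ true × coversᵇ HA (∁ (HA ∪ HC)) HC ≡ true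
complement-hand []           []           _ = refl , refl , refl
complement-hand (true  ∷ HA) (false ∷ HC) d = complement-hand HA HC d
complement-hand (false ∷ HA) (true  ∷ HC) d = complement-hand HA HC d
complement-hand (false ∷ HA) (false ∷ HC) d = complement-hand HA HC d

∣complement-hand∣ : ∀ {n} (HA HC : Subset n) → disjointᵇ HA HC ≡ true →
                    ∣ HA ∣ + ∣ ∁ (HA ∪ HC) ∣ + ∣ HC ∣ ≡ n
∣complement-hand∣ {n} HA HC d = begin
  ∣ HA ∣ + ∣ ∁ (HA ∪ HC) ∣ + ∣ HC ∣    ≡⟨ +-assoc ∣ HA ∣ _ _ ⟩
  ∣ HA ∣ + (∣ ∁ (HA ∪ HC) ∣ + ∣ HC ∣)  ≡⟨ cong (∣ HA ∣ +_) (+-comm _ ∣ HC ∣) ⟩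
  ∣ HA ∣ + (∣ HC ∣ + ∣ ∁ (HA ∪ HC) ∣)  ≡⟨ +-assoc ∣ HA ∣ _ _ ⟨
  ∣ HA ∣ + ∣ HC ∣ + ∣ ∁ (HA ∪ HC) ∣    ≡⟨ cong (_+ ∣ ∁ (HA ∪ HC) ∣) (∣p∪q∣≡∣p∣+∣q∣ HA HC (disjointᵇ⇒ HA HC d)) ⟨
  ∣ HA ∪ HC ∣ + ∣ ∁ (HA ∪ HC) ∣        ≡⟨ ∣p∣+∣∁p∣≡n (HA ∪ HC) ⟩
  n                                    ∎
  where open ≡-Reasoning

module Deals {n : ℕ} (a b c : ℕ) (a+b+c≡n : a + b + c ≡ n) where

  dealᵇ : Subset n → Subset n → Subset n → Bool
  dealᵇ HA HB HC = sizeᵇ HA a ∧ sizeᵇ HB b ∧ sizeᵇ HC c ∧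
                   disjointᵇ HA HB ∧ disjointᵇ HA HC ∧ disjointᵇ HB HC ∧ coversᵇ HA HB HC

  dealᵇ-given-Cathy : ∀ {HC} → ∣ HC ∣ ≡ c → ∀ HA HB →
    dealᵇ HA HB HC ≡ eqSubᵇ HB (∁ (HA ∪ HC)) ∧ (sizeᵇ HA a ∧ disjointᵇ HA HC)
  dealᵇ-given-Cathy {HC} ∣HC∣≡c HA HB = Bool-ext to from
    where
    Bob : Subset n
    Bob = ∁ (HA ∪ HC)
    ∣Bob∣≡b : ∣ HA ∣ ≡ a → disjointᵇ HA HC ≡ true → ∣ Bob ∣ ≡ b
    ∣Bob∣≡b ∣HA∣≡a dAC = +-cancelʳ-≡ c _ _ (+-cancelˡ-≡ a _ _ (begin
      a + (∣ Bob ∣ + c)             ≡⟨ +-assoc a _ c ⟨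
      a + ∣ Bob ∣ + c               ≡⟨ cong₂ (λ x y → x + ∣ Bob ∣ + y) ∣HA∣≡a ∣HC∣≡c ⟨
      ∣ HA ∣ + ∣ Bob ∣ + ∣ HC ∣     ≡⟨ ∣complement-hand∣ HA HC dAC ⟩
      n                             ≡⟨ a+b+c≡n ⟨
      a + b + c                     ≡⟨ +-assoc a b c ⟩
      a + (b + c)                   ∎))
      where open ≡-Reasoning
    to : dealᵇ HA HB HC ≡ true → eqSubᵇ HB Bob ∧ (sizeᵇ HA a ∧ disjointᵇ HA HC) ≡ true
    to deal =
      let (sa  , deal₁) = ∧-true⁻ {sizeᵇ HA a} deal
          (_   , deal₂) = ∧-true⁻ {sizeᵇ HB b} deal₁
          (_   , deal₃) = ∧-true⁻ {sizeᵇ HC c} deal₂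
          (dAB , deal₄) = ∧-true⁻ {disjointᵇ HA HB} deal₃
          (dAC , deal₅) = ∧-true⁻ {disjointᵇ HA HC} deal₄
          (dBC , cov)   = ∧-true⁻ {disjointᵇ HB HC} deal₅
          HB≡Bob        = bob-hand-unique HA HB HC dAB dBC cov
      in cong₂ _∧_ (subst (λ B → eqSubᵇ B Bob ≡ true) (sym HB≡Bob) (eqSubᵇ-refl Bob)) (cong₂ _∧_ sa dAC)
    from : eqSubᵇ HB Bob ∧ (sizeᵇ HA a ∧ disjointᵇ HA HC) ≡ true → dealᵇ HA HB HC ≡ true
    from e =
      let (HB≡Bob , e₁)      = ∧-true⁻ {eqSubᵇ HB Bob} e
          (sa , dAC)         = ∧-true⁻ {sizeᵇ HA a} e₁
          (dAB , dBC , cov)  = complement-hand HA HC dAC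
          sB                 = ⇒sizeᵇ {s = Bob} (∣Bob∣≡b (sizeᵇ⇒ {s = HA} sa) dAC)
          sC                 = ⇒sizeᵇ {s = HC} ∣HC∣≡c
      in subst (λ B → dealᵇ HA B HC ≡ true) (sym (eqSubᵇ⇒≡ {S = HB} HB≡Bob))
           (cong₂ _∧_ sa (cong₂ _∧_ sB (cong₂ _∧_ sC (cong₂ _∧_ dAB (cong₂ _∧_ dAC (cong₂ _∧_ dBC cov))))))

-- Strategies
avoiding : ∀ {n} → (Subset n → Bool) → Subset n → Fin n → ℕ
avoiding {n} 𝒜 C x = count (λ H → 𝒜 H ∧ (disjointᵇ H C ∧ lookup H x)) (allSubsets n)

Linear : ∀ {n} → (Subset n → Bool) → Set
Linear 𝒜 = ∀ {H K x y} → 𝒜 H ≡ true → 𝒜 K ≡ true → x ≢ y →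
           lookup H x ≡ true → lookup H y ≡ true → lookup K x ≡ true → lookup K y ≡ true → H ≡ K

Balanced : ∀ {n} → (Subset n → Bool) → ℕ → Set
Balanced 𝒜 c = ∀ C → ∣ C ∣ ≡ c → ∀ x y → lookup C x ≡ false → lookup C y ≡ false →
               avoiding 𝒜 C x ≡ avoiding 𝒜 C y

-- u = ∣H ∪ K∣ and i = ∣H ∩ K∣ for two a-sets H, K, and k = ∣∁ (H ∪ K)∣.
room-for-Bob : ∀ {a b c n u i k} → a + b + c ≡ n → a ≡ c + 2 → u + i ≡ a + a → 2 ≤ i → u + k ≡ n → b ≤ k
room-for-Bob {b = b} {c} {u = u} {i} {k} refl refl u+i≡2a 2≤i u+k≡n = +-cancelˡ-≤ u b k (begin
  u + b              ≤⟨ +-monoˡ-≤ b u≤c+2+c ⟩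
  c + 2 + c + b      ≡⟨ shuffle c b ⟩
  c + 2 + b + c      ≡⟨ u+k≡n ⟨
  u + k              ∎)
  where
  open ≤-Reasoning
  shuffle : ∀ c b → c + 2 + c + b ≡ c + 2 + b + c
  shuffle = solve-∀
  regroup : ∀ c → c + 2 + (c + 2) ≡ c + 2 + c + 2
  regroup = solve-∀
  u≤c+2+c : u ≤ c + 2 + c
  u≤c+2+c = +-cancelʳ-≤ 2 u (c + 2 + c) (begin
    u + 2              ≤⟨ +-monoʳ-≤ u 2≤i ⟩
    u + i              ≡⟨ u+i≡2a ⟩
    c + 2 + (c + 2)    ≡⟨ regroup c ⟩
    c + 2 + c + 2      ∎)

module _ {n a m : ℕ} (S : Strategy n a m) where
  open Strategy S

  equitable⇒uniform : Equitable S → ∀ {B} → ∣ B ∣ ≡ a →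
    Σ ℚ λ v → (∃[ w ] w ℚ.* v ≡ 1ℚ) × (∀ H → ∣ H ∣ ≡ a → ∀ j → p H j ≡ when (ann j H) v)
  equitable⇒uniform (γ , equitable) {B} ∣B∣≡a =
    v B ∣B∣≡a , (natℚ γ , γv≡1 B ∣B∣≡a) ,
    λ H ∣H∣≡a j → trans (p≡ H ∣H∣≡a j) (cong (when (ann j H)) (inverse-unique (natℚ γ) (γv≡1 H ∣H∣≡a) (γv≡1 B ∣B∣≡a)))
    where
    v : ∀ H → ∣ H ∣ ≡ a → ℚ
    v H ∣H∣≡a = p H (proj₁ (covers H ∣H∣≡a))
    p≡ : ∀ H (∣H∣≡a : ∣ H ∣ ≡ a) j → p H j ≡ when (ann j H) (v H ∣H∣≡a)
    p≡ H ∣H∣≡a j with ann j H in e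
    ... | true  = proj₂ (equitable H ∣H∣≡a) j _ e (proj₂ (covers H ∣H∣≡a))
    ... | false = p-zero H ∣H∣≡a j e
    γv≡1 : ∀ H (∣H∣≡a : ∣ H ∣ ≡ a) → natℚ γ ℚ.* v H ∣H∣≡a ≡ 1ℚ
    γv≡1 H ∣H∣≡a = begin
      natℚ γ ℚ.* v H ∣H∣≡a
        ≡⟨ cong (λ k → natℚ k ℚ.* v H ∣H∣≡a) (proj₁ (equitable H ∣H∣≡a)) ⟨
      natℚ (length (g S H)) ℚ.* v H ∣H∣≡a
        ≡⟨ cong (λ k → natℚ k ℚ.* v H ∣H∣≡a) (length-filter-≟ (λ j → ann j H) (allFin m)) ⟩
      natℚ (count (λ j → ann j H) (allFin m)) ℚ.* v H ∣H∣≡a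
        ≡⟨ ℚsum-indicator (λ j → ann j H) _ (allFin m) ⟨
      ℚsum (map (λ j → when (ann j H) (v H ∣H∣≡a)) (allFin m))
        ≡⟨ ℚsum-cong (p≡ H ∣H∣≡a) (allFin m) ⟨
      ℚsum (map (p H) (allFin m))
        ≡⟨ p-sum H ∣H∣≡a ⟩
      1ℚ ∎
      where open ≡-Reasoning

  module _ (b c : ℕ) (a+b+c≡n : a + b + c ≡ n) (v : ℚ)
           (uniform : ∀ H → ∣ H ∣ ≡ a → ∀ j → p H j ≡ when (ann j H) v) where
    open Deals a b c a+b+c≡n

    weight≡count : ∀ i {HC} → ∣ HC ∣ ≡ c → (E : Subset n → Bool) →
      weight S b c i HC E ≡ natℚ (count (λ H → ann i H ∧ (disjointᵇ H HC ∧ E H)) (allSubsets n)) ℚ.* v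
    weight≡count i {HC} ∣HC∣≡c E = begin
      weight S b c i HC E
        ≡⟨ ℚsum-filter _ _ triples ⟩
      ℚsum (map (λ { (HA , HB , HC′) → summand HA HB HC′ }) triples)
        ≡⟨ ℚsum-triples (λ { (HA , HB , HC′) → summand HA HB HC′ }) L L L ⟩
      ℚsum (map (λ HA → ℚsum (map (λ HB → ℚsum (map (summand HA HB) L)) L)) L)
        ≡⟨ ℚsum-cong alice L ⟩
      ℚsum (map (λ HA → when (ann i HA ∧ (disjointᵇ HA HC ∧ E HA)) v) L)
        ≡⟨ ℚsum-indicator _ v L ⟩
      natℚ (count (λ H → ann i H ∧ (disjointᵇ H HC ∧ E H)) L) ℚ.* v ∎
      where
      open ≡-Reasoning
      L : List (Subset n)
      L = allSubsets n
      triples : List (Subset n × Subset n × Subset n)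
      triples = concatMap (λ HA → concatMap (λ HB → map (λ HC′ → HA , HB , HC′) L) L) L
      summand : Subset n → Subset n → Subset n → ℚ
      summand HA HB HC′ = when (does (dealᵇ HA HB HC′ Bool.≟ true)) (when (eqSubᵇ HC′ HC ∧ E HA) (p HA i))
      alice : ∀ HA → ℚsum (map (λ HB → ℚsum (map (summand HA HB) L)) L)
                       ≡ when (ann i HA ∧ (disjointᵇ HA HC ∧ E HA)) v
      alice HA = begin
        ℚsum (map (λ HB → ℚsum (map (summand HA HB) L)) L)
          ≡⟨ ℚsum-cong (λ HB → trans (ℚsum-cong (cathy-first HB) L)
                                     (ℚsum-point HC (λ HC′ → when (dealᵇ HA HB HC′) W))) L ⟩
        ℚsum (map (λ HB → when (dealᵇ HA HB HC) W) L)
          ≡⟨ ℚsum-cong bob-first L ⟩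
        ℚsum (map (λ HB → when (eqSubᵇ HB Bob) (when (sizeᵇ HA a ∧ disjointᵇ HA HC) W)) L)
          ≡⟨ ℚsum-point Bob (λ _ → when (sizeᵇ HA a ∧ disjointᵇ HA HC) W) ⟩
        when (sizeᵇ HA a ∧ disjointᵇ HA HC) W
          ≡⟨ alice-hand ⟩
        when (ann i HA ∧ (disjointᵇ HA HC ∧ E HA)) v ∎
        where
        W : ℚ
        W = when (E HA) (p HA i)
        Bob : Subset n
        Bob = ∁ (HA ∪ HC)
        cathy-first : ∀ HB HC′ → summand HA HB HC′ ≡ when (eqSubᵇ HC′ HC) (when (dealᵇ HA HB HC′) W)
        cathy-first HB HC′ = begin
          summand HA HB HC′
            ≡⟨ cong₂ when (does-≟-true (dealᵇ HA HB HC′)) (when-∧ (eqSubᵇ HC′ HC) (E HA) (p HA i)) ⟩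
          when (dealᵇ HA HB HC′) (when (eqSubᵇ HC′ HC) W)
            ≡⟨ when-swap (dealᵇ HA HB HC′) (eqSubᵇ HC′ HC) W ⟩
          when (eqSubᵇ HC′ HC) (when (dealᵇ HA HB HC′) W) ∎
        bob-first : ∀ HB → when (dealᵇ HA HB HC) W ≡ when (eqSubᵇ HB Bob) (when (sizeᵇ HA a ∧ disjointᵇ HA HC) W)
        bob-first HB = trans (cong (λ x → when x W) (dealᵇ-given-Cathy {HC} ∣HC∣≡c HA HB)) (when-∧ (eqSubᵇ HB Bob) _ W)
        alice-hand : when (sizeᵇ HA a ∧ disjointᵇ HA HC) W ≡ when (ann i HA ∧ (disjointᵇ HA HC ∧ E HA)) v
        alice-hand with sizeᵇ HA a in sa
        ... | true rewrite uniform HA (sizeᵇ⇒ {s = HA} sa) i = when-nested (ann i HA) (disjointᵇ HA HC) (E HA) v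
        ... | false with ann i HA in announced
        ...   | false = refl
        ...   | true with () ← trans (sym sa) (⇒sizeᵇ {s = HA} (ann-size i HA announced))

  secure⇒balanced : ∀ {b c} → a + b + c ≡ n → 0 < a → Equitable S → Perfectly1Secure S b c →
                    ∀ {B} → ∣ B ∣ ≡ a → ∀ i → Balanced (ann i) c
  secure⇒balanced {b} {c} a+b+c≡n 0<a equitable secure {B} ∣B∣≡a i C ∣C∣≡c x y Cx Cy
    with equitable⇒uniform equitable {B} ∣B∣≡a | 𝒫 S C i in 𝒫≡
  ... | _ | [] = trans (nobody x) (sym (nobody y))
    where
    nobody : ∀ z → avoiding (ann i) C z ≡ 0
    nobody z = n≤0⇒n≡0 (begin
      avoiding (ann i) C z                                  ≤⟨ count-mono forget-z (allSubsets n) ⟩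
      count (λ H → ann i H ∧ disjointᵇ H C) (allSubsets n)  ≡⟨ length-filter-≟ _ (allSubsets n) ⟨
      length (𝒫 S C i)                                      ≡⟨ cong length 𝒫≡ ⟩
      0                                                     ∎)
      where
      open ≤-Reasoning
      forget-z : ∀ H → ann i H ∧ (disjointᵇ H C ∧ lookup H z) ≡ true → ann i H ∧ disjointᵇ H C ≡ true
      forget-z H e with ∧-true⁻ {ann i H} e
      ... | AH , rest = cong₂ _∧_ AH (proj₁ (∧-true⁻ {disjointᵇ H C} rest))
  ... | v , (w , wv≡1) , uniform | _ ∷ _ =
    *-cancelˡ-≡ (avoiding (ann i) C x) _ (a + b) {{>-nonZero (≤-trans 0<a (m≤m+n a b))}}
      (natℚ-injective (*-cancelʳ-invertible w wv≡1 (begin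
        natℚ ((a + b) * avoiding (ann i) C x) ℚ.* v         ≡⟨ scaled x ⟩
        natℚ (a + b) ℚ.* weight S b c i C (λ H → lookup H x) ≡⟨ secure i C ∣C∣≡c 𝒫≢[] x Cx ⟩
        natℚ a ℚ.* weight S b c i C (λ _ → true)            ≡⟨ secure i C ∣C∣≡c 𝒫≢[] y Cy ⟨
        natℚ (a + b) ℚ.* weight S b c i C (λ H → lookup H y) ≡⟨ scaled y ⟨
        natℚ ((a + b) * avoiding (ann i) C y) ℚ.* v         ∎)))
    where
    open ≡-Reasoning
    𝒫≢[] : ¬ (𝒫 S C i ≡ [])
    𝒫≢[] e with () ← trans (sym 𝒫≡) e
    scaled : ∀ z → natℚ ((a + b) * avoiding (ann i) C z) ℚ.* v ≡ natℚ (a + b) ℚ.* weight S b c i C (λ H → lookup H z)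
    scaled z = begin
      natℚ ((a + b) * avoiding (ann i) C z) ℚ.* v                 ≡⟨ cong (ℚ._* v) (natℚ-* (a + b) _) ⟩
      natℚ (a + b) ℚ.* natℚ (avoiding (ann i) C z) ℚ.* v          ≡⟨ ℚ.*-assoc (natℚ (a + b)) _ v ⟩
      natℚ (a + b) ℚ.* (natℚ (avoiding (ann i) C z) ℚ.* v)        ≡⟨ cong (natℚ (a + b) ℚ.*_) (weight≡count b c a+b+c≡n v uniform i ∣C∣≡c (λ H → lookup H z)) ⟨
      natℚ (a + b) ℚ.* weight S b c i C (λ H → lookup H z)         ∎

  informative⇒linear : ∀ {b c} → a + b + c ≡ n → a ≡ c + 2 → InformativeForBob S b → ∀ i → Linear (ann i)
  informative⇒linear {b} a+b+c≡n a≡c+2 informative i {H} {K} {x} {y} AH AK x≢y Hx Hy Kx Ky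
    with ≡-dec Bool._≟_ H K
  ... | yes H≡K = H≡K
  ... | no  H≢K = ⊥-elim (<⇒≱ (s≤s (s≤s z≤n)) (≤-trans two-hands (informative HB ∣HB∣≡b i)))
    where
    H∪K : Subset n
    H∪K = H ∪ K
    b≤∣∁H∪K∣ : b ≤ ∣ ∁ H∪K ∣
    b≤∣∁H∪K∣ = room-for-Bob a+b+c≡n a≡c+2
      (trans (∣p∪q∣+∣p∩q∣≡∣p∣+∣q∣ H K) (cong₂ _+_ (ann-size i H AH) (ann-size i K AK)))
      (2≤∣p∣ (H ∩ K) x≢y (both Hx Kx) (both Hy Ky))
      (∣p∣+∣∁p∣≡n H∪K)
      where
      both : ∀ {z} → lookup H z ≡ true → lookup K z ≡ true → lookup (H ∩ K) z ≡ true
      both {z} Hz Kz = trans (lookup-zipWith _∧_ z H K) (cong₂ _∧_ Hz Kz)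
    HB : Subset n
    HB = proj₁ (select (∁ H∪K) b b≤∣∁H∪K∣)
    ∣HB∣≡b : ∣ HB ∣ ≡ b
    ∣HB∣≡b = proj₁ (proj₂ (select (∁ H∪K) b b≤∣∁H∪K∣))
    HB⊆∁H∪K : ∀ z → lookup HB z ≡ true → lookup (∁ H∪K) z ≡ true
    HB⊆∁H∪K = proj₂ (proj₂ (select (∁ H∪K) b b≤∣∁H∪K∣))
    misses-Bob : ∀ J → (∀ z → lookup J z ≡ true → lookup H∪K z ≡ true) → ann i J ≡ true →
                 ann i J ∧ disjointᵇ J HB ≡ true
    misses-Bob J J⊆H∪K AJ = cong₂ _∧_ AJ (⇒disjointᵇ J HB outside)
      where
      outside : ∀ z → lookup J z ≡ true → lookup HB z ≡ false
      outside z Jz with lookup HB z in HBz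
      ... | false = refl
      ... | true with () ← trans (sym (cong not (J⊆H∪K z Jz)))
                             (trans (sym (lookup-map z not H∪K)) (HB⊆∁H∪K z HBz))
    two-hands : 2 ≤ length (𝒫 S HB i)
    two-hands = subst (2 ≤_) (sym (length-filter-≟ _ (allSubsets n)))
      (count-≥2 (∈-allSubsets H) (∈-allSubsets K) H≢K
        (misses-Bob H (λ z Hz → trans (lookup-zipWith _∨_ z H K) (cong (_∨ lookup K z) Hz)) AH)
        (misses-Bob K (λ z Kz → trans (lookup-zipWith _∨_ z H K)
                                      (trans (cong (lookup H z ∨_) Kz) (Bool.∨-zeroʳ (lookup H z)))) AK))

-- Linear balanced families
inclusion-exclusion₂ : ∀ A d X P Q →
  𝟙 (A ∧ ((d ∧ (not P ∧ not Q)) ∧ X)) + 𝟙 (A ∧ (d ∧ (X ∧ P))) + 𝟙 (A ∧ (d ∧ (X ∧ Q)))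
    ≡ 𝟙 (A ∧ (d ∧ X)) + 𝟙 (A ∧ (d ∧ (X ∧ (P ∧ Q))))
inclusion-exclusion₂ false d     X     P     Q     = refl
inclusion-exclusion₂ true  false X     P     Q     = refl
inclusion-exclusion₂ true  true  false true  true  = refl
inclusion-exclusion₂ true  true  false true  false = refl
inclusion-exclusion₂ true  true  false false true  = refl
inclusion-exclusion₂ true  true  false false false = refl
inclusion-exclusion₂ true  true  true  true  true  = refl
inclusion-exclusion₂ true  true  true  true  false = refl
inclusion-exclusion₂ true  true  true  false true  = refl
inclusion-exclusion₂ true  true  true  false false = refl

module Avoiding {n c₀ : ℕ} (𝒜 : Subset n → Bool) (linear : Linear 𝒜) (balanced : Balanced 𝒜 (2 + c₀))
                {B : Subset n} (AB : 𝒜 B ≡ true)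
                {D : Subset n} (∣D∣≡c₀ : ∣ D ∣ ≡ c₀) (B∌D : ∀ x → lookup B x ≡ true → lookup D x ≡ false) where

  through : (Subset n → Bool) → ℕ
  through P = count (λ H → 𝒜 H ∧ (disjointᵇ H D ∧ P H)) (allSubsets n)

  member⁻ : ∀ {H} (P : Subset n → Bool) → 𝒜 H ∧ (disjointᵇ H D ∧ P H) ≡ true →
            𝒜 H ≡ true × disjointᵇ H D ≡ true × P H ≡ true
  member⁻ {H} P e with ∧-true⁻ {𝒜 H} e
  ... | AH , e′ = AH , ∧-true⁻ {disjointᵇ H D} e′

  through-mono : ∀ {P Q} → (∀ H → P H ≡ true → Q H ≡ true) → through P ≤ through Q
  through-mono {P} P⇒Q = count-mono (λ H e → let (AH , dH , PH) = member⁻ {H} P e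
                                               in cong₂ _∧_ AH (cong₂ _∧_ dH (P⇒Q H PH))) (allSubsets n)

  through-≥1 : ∀ {P H} → 𝒜 H ≡ true → disjointᵇ H D ≡ true → P H ≡ true → 1 ≤ through P
  through-≥1 {P} {H} AH dH PH = count-≥1 (∈-allSubsets H) (cong₂ _∧_ AH (cong₂ _∧_ dH PH))

  through-≡0 : ∀ {P} → (∀ H → 𝒜 H ≡ true → P H ≡ true → ⊥) → through P ≡ 0
  through-≡0 {P} none = count-≡0 (λ H e → let (AH , _ , PH) = member⁻ {H} P e in none H AH PH) (allSubsets n)

  through-witness : ∀ {P} → 0 < through P → ∃[ H ] 𝒜 H ≡ true × disjointᵇ H D ≡ true × P H ≡ true
  through-witness {P} h with count-witness (allSubsets n) h
  ... | H , e = H , member⁻ {H} P e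

  through-≤1 : ∀ {P} → (∀ {H K} → 𝒜 H ≡ true → 𝒜 K ≡ true → P H ≡ true → P K ≡ true → H ≡ K) →
               through P ≤ 1
  through-≤1 {P} unique with through P in e
  ... | zero  = z≤n
  ... | suc k with through-witness {P} (subst (0 <_) (sym e) (s≤s z≤n))
  ...   | K , AK , _ , PK = begin
    suc k                                    ≡⟨ e ⟨
    through P                                ≤⟨ count-mono is-K (allSubsets n) ⟩
    count (λ H → eqSubᵇ H K) (allSubsets n)  ≡⟨ count-allSubsets-eqSubᵇ K ⟩
    1                                        ∎
    where
    open ≤-Reasoning
    is-K : ∀ H → 𝒜 H ∧ (disjointᵇ H D ∧ P H) ≡ true → eqSubᵇ H K ≡ true
    is-K H e′ with member⁻ {H} P e′
    ... | AH , _ , PH = subst (λ J → eqSubᵇ J K ≡ true) (sym (unique AH AK PH PK)) (eqSubᵇ-refl K)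

  r₁ : Fin n → ℕ
  r₁ x = through (λ H → lookup H x)

  r₂ : Fin n → Fin n → ℕ
  r₂ x y = through (λ H → lookup H x ∧ lookup H y)

  r₃ : Fin n → Fin n → Fin n → ℕ
  r₃ x y z = through (λ H → lookup H x ∧ (lookup H y ∧ lookup H z))

  r₂-sym : ∀ x y → r₂ x y ≡ r₂ y x
  r₂-sym x y = count-cong (λ H → cong (λ z → 𝒜 H ∧ (disjointᵇ H D ∧ z)) (Bool.∧-comm (lookup H x) (lookup H y)))
                          (allSubsets n)

  r₂≤1 : ∀ {x y} → x ≢ y → r₂ x y ≤ 1
  r₂≤1 {x} {y} x≢y = through-≤1 (λ {H} {K} AH AK HK KK →
    let (Hx , Hy) = ∧-true⁻ {lookup H x} HK ; (Kx , Ky) = ∧-true⁻ {lookup K x} KK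
    in linear AH AK x≢y Hx Hy Kx Ky)

  r₃≤r₂ : ∀ x y z → r₃ x y z ≤ r₂ x y
  r₃≤r₂ x y z = through-mono (λ H e → let (Hx , Hyz) = ∧-true⁻ {lookup H x} e
                                      in cong₂ _∧_ Hx (proj₁ (∧-true⁻ {lookup H y} Hyz)))

  r₃≡0 : ∀ {x y} z → r₂ x y ≡ 0 → r₃ x y z ≡ 0
  r₃≡0 {x} {y} z e = n≤0⇒n≡0 (≤-trans (r₃≤r₂ x y z) (≤-reflexive e))

  B∩D≡∅ : disjointᵇ B D ≡ true
  B∩D≡∅ = ⇒disjointᵇ B D B∌D

  r₂-B : ∀ {x y} → lookup B x ≡ true → lookup B y ≡ true → x ≢ y → r₂ x y ≡ 1
  r₂-B Bx By x≢y = ≤-antisym (r₂≤1 x≢y) (through-≥1 AB B∩D≡∅ (cong₂ _∧_ Bx By))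

  r₃-B : ∀ {x y z} → lookup B x ≡ true → lookup B y ≡ true → lookup B z ≡ true → x ≢ y → r₃ x y z ≡ 1
  r₃-B {x} {y} {z} Bx By Bz x≢y =
    ≤-antisym (≤-trans (r₃≤r₂ x y z) (r₂≤1 x≢y)) (through-≥1 AB B∩D≡∅ (cong₂ _∧_ Bx (cong₂ _∧_ By Bz)))

  -- by linearity B is the only member through two of its points
  r₃-B-B-∉B : ∀ {x y z} → lookup B x ≡ true → lookup B y ≡ true → x ≢ y → lookup B z ≡ false → r₃ x y z ≡ 0
  r₃-B-B-∉B {x} {y} {z} Bx By x≢y Bz = through-≡0 λ H AH e →
    let (Hx , Hyz) = ∧-true⁻ {lookup H x} e ; (Hy , Hz) = ∧-true⁻ {lookup H y} Hyz
    in case trans (sym Bz) (subst (λ J → lookup J z ≡ true) (linear AH AB x≢y Hx Hy Bx By) Hz) of λ ()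

  r₃-∉B-B-B : ∀ {x y z} → lookup B x ≡ false → lookup B y ≡ true → lookup B z ≡ true → y ≢ z → r₃ x y z ≡ 0
  r₃-∉B-B-B {x} {y} {z} Bx By Bz y≢z = through-≡0 λ H AH e →
    let (Hx , Hyz) = ∧-true⁻ {lookup H x} e ; (Hy , Hz) = ∧-true⁻ {lookup H y} Hyz
    in case trans (sym Bx) (subst (λ J → lookup J x ≡ true) (linear AH AB y≢z Hy Hz By Bz) Hx) of λ ()

  cut : Fin n → Fin n → Subset n
  cut p q = D ∪ (⁅ p ⁆ ∪ ⁅ q ⁆)

  ∣cut∣ : ∀ {p q} → p ≢ q → lookup D p ≡ false → lookup D q ≡ false → ∣ cut p q ∣ ≡ 2 + c₀
  ∣cut∣ {p} {q} p≢q Dp Dq = begin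
    ∣ D ∪ (⁅ p ⁆ ∪ ⁅ q ⁆) ∣      ≡⟨ ∣p∪q∣≡∣p∣+∣q∣ D _ D∌pq ⟩
    ∣ D ∣ + ∣ ⁅ p ⁆ ∪ ⁅ q ⁆ ∣    ≡⟨ cong₂ _+_ ∣D∣≡c₀ (∣p∪q∣≡∣p∣+∣q∣ ⁅ p ⁆ ⁅ q ⁆ p∌q) ⟩
    c₀ + (∣ ⁅ p ⁆ ∣ + ∣ ⁅ q ⁆ ∣) ≡⟨ cong₂ (λ u v → c₀ + (u + v)) (∣⁅x⁆∣≡1 p) (∣⁅x⁆∣≡1 q) ⟩
    c₀ + 2                       ≡⟨ +-comm c₀ 2 ⟩
    2 + c₀                       ∎
    where
    open ≡-Reasoning
    p∌q : ∀ z → lookup ⁅ p ⁆ z ≡ true → lookup ⁅ q ⁆ z ≡ false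
    p∌q z pz = subst (λ w → lookup ⁅ q ⁆ w ≡ false) (sym (lookup-⁅y⁆⇒≡ pz)) (lookup-⁅y⁆-x p≢q)
    D∌pq : ∀ z → lookup D z ≡ true → lookup (⁅ p ⁆ ∪ ⁅ q ⁆) z ≡ false
    D∌pq z Dz = trans (lookup-zipWith _∨_ z ⁅ p ⁆ ⁅ q ⁆)
      (cong₂ _∨_ (lookup-⁅y⁆-x {x = z} {p} (λ { refl → case trans (sym Dp) Dz of λ () }))
                 (lookup-⁅y⁆-x {x = z} {q} (λ { refl → case trans (sym Dq) Dz of λ () })))

  ∉cut : ∀ {p q x} → lookup D x ≡ false → x ≢ p → x ≢ q → lookup (cut p q) x ≡ false
  ∉cut {p} {q} {x} Dx x≢p x≢q = begin
    lookup (D ∪ (⁅ p ⁆ ∪ ⁅ q ⁆)) x               ≡⟨ lookup-zipWith _∨_ x D _ ⟩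
    lookup D x ∨ lookup (⁅ p ⁆ ∪ ⁅ q ⁆) x        ≡⟨ cong₂ _∨_ Dx (lookup-zipWith _∨_ x ⁅ p ⁆ ⁅ q ⁆) ⟩
    lookup ⁅ p ⁆ x ∨ lookup ⁅ q ⁆ x              ≡⟨ cong₂ _∨_ (lookup-⁅y⁆-x x≢p) (lookup-⁅y⁆-x x≢q) ⟩
    false                                        ∎
    where open ≡-Reasoning

  inclusion-exclusion : ∀ p q x → avoiding 𝒜 (cut p q) x + r₂ x p + r₂ x q ≡ r₁ x + r₃ x p q
  inclusion-exclusion p q x = count-linear pointwise (allSubsets n)
    where
    pointwise : ∀ H → 𝟙 (𝒜 H ∧ (disjointᵇ H (cut p q) ∧ lookup H x))
                        + 𝟙 (𝒜 H ∧ (disjointᵇ H D ∧ (lookup H x ∧ lookup H p)))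
                        + 𝟙 (𝒜 H ∧ (disjointᵇ H D ∧ (lookup H x ∧ lookup H q)))
                      ≡ 𝟙 (𝒜 H ∧ (disjointᵇ H D ∧ lookup H x))
                        + 𝟙 (𝒜 H ∧ (disjointᵇ H D ∧ (lookup H x ∧ (lookup H p ∧ lookup H q))))
    pointwise H rewrite disjointᵇ-∪ H D (⁅ p ⁆ ∪ ⁅ q ⁆) | disjointᵇ-∪ H ⁅ p ⁆ ⁅ q ⁆
                      | disjointᵇ-⁅⁆ H p | disjointᵇ-⁅⁆ H q =
      inclusion-exclusion₂ (𝒜 H) (disjointᵇ H D) (lookup H x) (lookup H p) (lookup H q)

  balance : ∀ {p q x y} → p ≢ q → lookup D p ≡ false → lookup D q ≡ false →
            lookup D x ≡ false → x ≢ p → x ≢ q → lookup D y ≡ false → y ≢ p → y ≢ q →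
            r₃ x p q + (r₂ y p + (r₂ y q + r₁ x)) ≡ r₃ y p q + (r₂ x p + (r₂ x q + r₁ y))
  balance {p} {q} {x} {y} p≢q Dp Dq Dx x≢p x≢q Dy y≢p y≢q = +-cancelˡ-≡ (U x) _ _ (begin
    U x + (r₃ x p q + (r₂ y p + (r₂ y q + r₁ x)))  ≡⟨ regroup (U x) (r₃ x p q) (r₂ y p) (r₂ y q) (r₁ x) ⟩
    U x + r₂ y p + r₂ y q + (r₁ x + r₃ x p q)      ≡⟨ cong (λ u → u + r₂ y p + r₂ y q + (r₁ x + r₃ x p q)) Ux≡Uy ⟩
    U y + r₂ y p + r₂ y q + (r₁ x + r₃ x p q)      ≡⟨ cong (_+ (r₁ x + r₃ x p q)) (inclusion-exclusion p q y) ⟩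
    r₁ y + r₃ y p q + (r₁ x + r₃ x p q)            ≡⟨ +-comm (r₁ y + r₃ y p q) _ ⟩
    r₁ x + r₃ x p q + (r₁ y + r₃ y p q)            ≡⟨ cong (_+ (r₁ y + r₃ y p q)) (inclusion-exclusion p q x) ⟨
    U x + r₂ x p + r₂ x q + (r₁ y + r₃ y p q)      ≡⟨ regroup (U x) (r₃ y p q) (r₂ x p) (r₂ x q) (r₁ y) ⟨
    U x + (r₃ y p q + (r₂ x p + (r₂ x q + r₁ y)))  ∎)
    where
    open ≡-Reasoning
    U : Fin n → ℕ
    U = avoiding 𝒜 (cut p q)
    Ux≡Uy : U x ≡ U y
    Ux≡Uy = balanced (cut p q) (∣cut∣ p≢q Dp Dq) x y (∉cut Dx x≢p x≢q) (∉cut Dy y≢p y≢q)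
    regroup : ∀ u t l l′ r → u + (t + (l + (l′ + r))) ≡ u + l + l′ + (r + t)
    regroup = solve-∀

  balance-at : ∀ {p q x y} → p ≢ q → lookup D p ≡ false → lookup D q ≡ false →
               lookup D x ≡ false → x ≢ p → x ≢ q → lookup D y ≡ false → y ≢ p → y ≢ q →
               ∀ {t l l′ t′ k k′} → r₃ x p q ≡ t → r₂ y p ≡ l → r₂ y q ≡ l′ →
               r₃ y p q ≡ t′ → r₂ x p ≡ k → r₂ x q ≡ k′ →
               t + (l + (l′ + r₁ x)) ≡ t′ + (k + (k′ + r₁ y))
  balance-at p≢q Dp Dq Dx x≢p x≢q Dy y≢p y≢q refl refl refl refl refl refl =
    balance p≢q Dp Dq Dx x≢p x≢q Dy y≢p y≢q

  ∉B⇒≢ : ∀ {x y} → lookup B x ≡ true → lookup B y ≡ false → x ≢ y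
  ∉B⇒≢ Bx By refl = case trans (sym By) Bx of λ ()

  r₁-B : ∀ {x y p q} → lookup B x ≡ true → lookup B y ≡ true → lookup B p ≡ true → lookup B q ≡ true →
         p ≢ q → x ≢ p → x ≢ q → y ≢ p → y ≢ q → r₁ x ≡ r₁ y
  r₁-B Bx By Bp Bq p≢q x≢p x≢q y≢p y≢q = suc-injective (suc-injective (suc-injective
    (balance-at p≢q (B∌D _ Bp) (B∌D _ Bq) (B∌D _ Bx) x≢p x≢q (B∌D _ By) y≢p y≢q
      (r₃-B Bx Bp Bq x≢p) (r₂-B By Bp y≢p) (r₂-B By Bq y≢q)
      (r₃-B By Bp Bq y≢p) (r₂-B Bx Bp x≢p) (r₂-B Bx Bq x≢q))))

  r₁-∉B : ∀ {x p q o} → lookup B x ≡ true → lookup B p ≡ true → lookup B q ≡ true →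
          p ≢ q → x ≢ p → x ≢ q → lookup B o ≡ false → lookup D o ≡ false →
          suc (r₁ o) ≡ r₂ o p + (r₂ o q + r₁ x)
  r₁-∉B Bx Bp Bq p≢q x≢p x≢q Bo Do = suc-injective
    (balance-at p≢q (B∌D _ Bp) (B∌D _ Bq) Do (∉B⇒≢ Bp Bo ∘ sym) (∉B⇒≢ Bq Bo ∘ sym) (B∌D _ Bx) x≢p x≢q
      (r₃-∉B-B-B Bo Bp Bq p≢q) (r₂-B Bx Bp x≢p) (r₂-B Bx Bq x≢q) (r₃-B Bx Bp Bq x≢p) refl refl)

  module _ (large : ∀ H → 𝒜 H ≡ true → 3 ≤ ∣ H ∣)
           {b₁ b₂ b₃ b₄ : Fin n}
           (B₁ : lookup B b₁ ≡ true) (B₂ : lookup B b₂ ≡ true) (B₃ : lookup B b₃ ≡ true) (B₄ : lookup B b₄ ≡ true)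
           (b₁≢b₂ : b₁ ≢ b₂) (b₁≢b₃ : b₁ ≢ b₃) (b₁≢b₄ : b₁ ≢ b₄)
           (b₂≢b₃ : b₂ ≢ b₃) (b₂≢b₄ : b₂ ≢ b₄) (b₃≢b₄ : b₃ ≢ b₄) where

    r₁b₂≡r₁b₁ : r₁ b₂ ≡ r₁ b₁
    r₁b₂≡r₁b₁ = r₁-B B₂ B₁ B₃ B₄ b₃≢b₄ b₂≢b₃ b₂≢b₄ b₁≢b₃ b₁≢b₄

    r₁b₃≡r₁b₁ : r₁ b₃ ≡ r₁ b₁
    r₁b₃≡r₁b₁ = r₁-B B₃ B₁ B₂ B₄ b₂≢b₄ (b₂≢b₃ ∘ sym) b₃≢b₄ b₁≢b₂ b₁≢b₄

    module Outside {o : Fin n} (Bo : lookup B o ≡ false) (Do : lookup D o ≡ false) where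

      r₂ob₂≡r₂ob₁ : r₂ o b₂ ≡ r₂ o b₁
      r₂ob₂≡r₂ob₁ = +-cancelʳ-≡ (r₂ o b₃ + r₁ b₁) _ _ (begin
        r₂ o b₂ + (r₂ o b₃ + r₁ b₁)  ≡⟨ r₁-∉B B₁ B₂ B₃ b₂≢b₃ b₁≢b₂ b₁≢b₃ Bo Do ⟨
        suc (r₁ o)                   ≡⟨ r₁-∉B B₂ B₁ B₃ b₁≢b₃ (b₁≢b₂ ∘ sym) b₂≢b₃ Bo Do ⟩
        r₂ o b₁ + (r₂ o b₃ + r₁ b₂)  ≡⟨ cong (λ r → r₂ o b₁ + (r₂ o b₃ + r)) r₁b₂≡r₁b₁ ⟩
        r₂ o b₁ + (r₂ o b₃ + r₁ b₁)  ∎)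
        where open ≡-Reasoning

      suc-r₁o : suc (r₁ o) ≡ r₂ o b₁ + (r₂ o b₁ + r₁ b₁)
      suc-r₁o = trans (r₁-∉B B₃ B₁ B₂ b₁≢b₂ (b₁≢b₃ ∘ sym) (b₂≢b₃ ∘ sym) Bo Do)
                      (cong₂ (λ l r → r₂ o b₁ + (l + r)) r₂ob₂≡r₂ob₁ r₁b₃≡r₁b₁)

      -- A member K through o and b₁ would contain a third point o′ outside B, and the balance
      -- at the cut {b₁, o′} between o and b₂ would fail.
      r₂ob₁≢1 : r₂ o b₁ ≢ 1
      r₂ob₁≢1 r₂ob₁≡1 with through-witness {λ H → lookup H o ∧ lookup H b₁} (subst (0 <_) (sym r₂ob₁≡1) (s≤s z≤n))
      ... | K , AK , K∩D≡∅ , Ko∧Kb₁ with ∧-true⁻ {lookup K o} Ko∧Kb₁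
      ... | Ko , Kb₁ with pick K (o ∷ b₁ ∷ []) (large K AK)
      ... | o′ , Ko′ , o′≢o ∷ o′≢b₁ ∷ [] = m≢1+n+m (r₁ b₁) (begin
        r₁ b₁                     ≡⟨ trans (suc-injective (suc-injective at-cut)) r₁b₂≡r₁b₁ ⟨
        r₂ b₂ o′ + r₁ o           ≡⟨ cong (r₂ b₂ o′ +_) r₁o≡1+r₁b₁ ⟩
        r₂ b₂ o′ + suc (r₁ b₁)    ≡⟨ +-suc (r₂ b₂ o′) (r₁ b₁) ⟩
        suc (r₂ b₂ o′ + r₁ b₁)    ∎)
        where
        open ≡-Reasoning
        Bo′ : lookup B o′ ≡ false
        Bo′ with lookup B o′ in Bo′
        ... | false = refl
        ... | true  = case trans (sym Bo) (subst (λ J → lookup J o ≡ true)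
                             (linear AK AB (o′≢b₁ ∘ sym) Kb₁ Ko′ B₁ Bo′) Ko) of λ ()
        r₁o≡1+r₁b₁ : r₁ o ≡ suc (r₁ b₁)
        r₁o≡1+r₁b₁ = suc-injective (trans suc-r₁o (cong (λ l → l + (l + r₁ b₁)) r₂ob₁≡1))
        at-cut : 1 + (1 + (r₂ b₂ o′ + r₁ o)) ≡ 0 + (1 + (1 + r₁ b₂))
        at-cut = balance-at (o′≢b₁ ∘ sym) (B∌D _ B₁) (disjointᵇ⇒ K D K∩D≡∅ o′ Ko′)
          Do (∉B⇒≢ B₁ Bo ∘ sym) (o′≢o ∘ sym) (B∌D _ B₂) (b₁≢b₂ ∘ sym) (∉B⇒≢ B₂ Bo′)
          (≤-antisym (≤-trans (r₃≤r₂ o b₁ o′) (≤-reflexive r₂ob₁≡1))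
                     (through-≥1 AK K∩D≡∅ (cong₂ _∧_ Ko (cong₂ _∧_ Kb₁ Ko′))))
          (r₂-B B₂ B₁ (b₁≢b₂ ∘ sym)) refl (r₃-B-B-∉B B₂ B₁ (b₁≢b₂ ∘ sym) Bo′) r₂ob₁≡1
          (≤-antisym (r₂≤1 (o′≢o ∘ sym)) (through-≥1 AK K∩D≡∅ (cong₂ _∧_ Ko Ko′)))

      r₂ob₁≡0 : r₂ o b₁ ≡ 0
      r₂ob₁≡0 with r₂ o b₁ in r₂ob₁≡ | r₂≤1 (∉B⇒≢ B₁ Bo ∘ sym)
      ... | zero        | _        = refl
      ... | suc zero    | _        = ⊥-elim (r₂ob₁≢1 r₂ob₁≡)
      ... | suc (suc _) | s≤s ()

      r₂b₂o≡0 : r₂ b₂ o ≡ 0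
      r₂b₂o≡0 = trans (r₂-sym b₂ o) (trans r₂ob₂≡r₂ob₁ r₂ob₁≡0)

      suc-r₁o≡r₁b₁ : suc (r₁ o) ≡ r₁ b₁
      suc-r₁o≡r₁b₁ = trans suc-r₁o (cong (λ l → l + (l + r₁ b₁)) r₂ob₁≡0)

    r₂-outside : ∀ {y o} → lookup B y ≡ false → lookup D y ≡ false → lookup B o ≡ false → lookup D o ≡ false →
                 y ≢ o → r₂ y o ≡ 0
    r₂-outside {y} {o} By Dy Bo Do y≢o = +-cancelʳ-≡ (r₁ b₁) (r₂ y o) 0 (begin
      r₂ y o + r₁ b₁   ≡⟨ cong (r₂ y o +_) r₁b₂≡r₁b₁ ⟨
      r₂ y o + r₁ b₂   ≡⟨ at-cut ⟨
      suc (r₁ y)       ≡⟨ Outside.suc-r₁o≡r₁b₁ By Dy ⟩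
      r₁ b₁            ∎)
      where
      open ≡-Reasoning
      at-cut : 0 + (1 + (0 + r₁ y)) ≡ 0 + (0 + (r₂ y o + r₁ b₂))
      at-cut = balance-at (∉B⇒≢ B₁ Bo) (B∌D _ B₁) Do Dy (∉B⇒≢ B₁ By ∘ sym) y≢o (B∌D _ B₂) (b₁≢b₂ ∘ sym) (∉B⇒≢ B₂ Bo)
        (r₃≡0 o (Outside.r₂ob₁≡0 By Dy)) (r₂-B B₂ B₁ (b₁≢b₂ ∘ sym)) (Outside.r₂b₂o≡0 Bo Do)
        (r₃-B-B-∉B B₂ B₁ (b₁≢b₂ ∘ sym) Bo) (Outside.r₂ob₁≡0 By Dy) refl

    three-outside-impossible : ∀ {p q y} → lookup B p ≡ false → lookup D p ≡ false → lookup B q ≡ false → lookup D q ≡ false →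
      lookup B y ≡ false → lookup D y ≡ false → p ≢ q → y ≢ p → y ≢ q → ⊥
    three-outside-impossible {p} {q} {y} Bp Dp Bq Dq By Dy p≢q y≢p y≢q = 1+n≢n (begin
      suc (r₁ b₁)  ≡⟨ cong suc at-cut ⟨
      suc (r₁ y)   ≡⟨ Outside.suc-r₁o≡r₁b₁ By Dy ⟩
      r₁ b₁        ∎)
      where
      open ≡-Reasoning
      r₂b₁p≡0 : r₂ b₁ p ≡ 0
      r₂b₁p≡0 = trans (r₂-sym b₁ p) (Outside.r₂ob₁≡0 Bp Dp)
      r₂b₁q≡0 : r₂ b₁ q ≡ 0
      r₂b₁q≡0 = trans (r₂-sym b₁ q) (Outside.r₂ob₁≡0 Bq Dq)
      at-cut : 0 + (0 + (0 + r₁ y)) ≡ 0 + (0 + (0 + r₁ b₁))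
      at-cut = balance-at p≢q Dp Dq Dy y≢p y≢q (B∌D _ B₁) (∉B⇒≢ B₁ Bp) (∉B⇒≢ B₁ Bq)
        (r₃≡0 q (r₂-outside By Dy Bp Dp y≢p)) r₂b₁p≡0 r₂b₁q≡0 (r₃≡0 q r₂b₁p≡0)
        (r₂-outside By Dy Bp Dp y≢p) (r₂-outside By Dy Bq Dq y≢q)

no-linear-balanced-family : ∀ {n a c₀} (𝒜 : Subset n → Bool) → (∀ H → 𝒜 H ≡ true → ∣ H ∣ ≡ a) →
  4 ≤ a → a + (3 + c₀) ≤ n → Linear 𝒜 → Balanced 𝒜 (2 + c₀) → ∀ {B} → 𝒜 B ≡ true → ⊥
no-linear-balanced-family {n} {a} {c₀} 𝒜 size 4≤a room linear balanced {B} AB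
  with select (∁ B) c₀ c₀≤∣∁B∣
  where
  c₀≤∣∁B∣ : c₀ ≤ ∣ ∁ B ∣
  c₀≤∣∁B∣ = m+n≤o⇒n≤o 3 (+-cancelˡ-≤ a _ _ (begin
    a + (3 + c₀)       ≤⟨ room ⟩
    n                  ≡⟨ ∣p∣+∣∁p∣≡n B ⟨
    ∣ B ∣ + ∣ ∁ B ∣    ≡⟨ cong (_+ ∣ ∁ B ∣) (size B AB) ⟩
    a + ∣ ∁ B ∣        ∎))
    where open ≤-Reasoning
... | D , ∣D∣≡c₀ , D⊆∁B = contradiction
  where
  B∌D : ∀ x → lookup B x ≡ true → lookup D x ≡ false
  B∌D x Bx with lookup D x in Dx
  ... | false = refl
  ... | true  = case trans (cong not (sym Bx)) (trans (sym (lookup-map x not B)) (D⊆∁B x Dx)) of λ ()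

  O : Subset n
  O = ∁ (B ∪ D)

  outside⁻ : ∀ {x} → lookup O x ≡ true → lookup B x ≡ false × lookup D x ≡ false
  outside⁻ {x} Ox = not-∨-true⁻ (begin
    not (lookup B x ∨ lookup D x)  ≡⟨ cong not (lookup-zipWith _∨_ x B D) ⟨
    not (lookup (B ∪ D) x)         ≡⟨ lookup-map x not (B ∪ D) ⟨
    lookup O x                     ≡⟨ Ox ⟩
    true                           ∎)
    where open ≡-Reasoning

  3≤∣O∣ : 3 ≤ ∣ O ∣
  3≤∣O∣ = +-cancelˡ-≤ (a + c₀) 3 ∣ O ∣ (begin
    a + c₀ + 3          ≡⟨ regroup a c₀ ⟩
    a + (3 + c₀)        ≤⟨ room ⟩
    n                   ≡⟨ ∣p∣+∣∁p∣≡n (B ∪ D) ⟨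
    ∣ B ∪ D ∣ + ∣ O ∣   ≡⟨ cong (_+ ∣ O ∣) (∣p∪q∣≡∣p∣+∣q∣ B D B∌D) ⟩
    ∣ B ∣ + ∣ D ∣ + ∣ O ∣ ≡⟨ cong₂ (λ u v → u + v + ∣ O ∣) (size B AB) ∣D∣≡c₀ ⟩
    a + c₀ + ∣ O ∣      ∎)
    where
    open ≤-Reasoning
    regroup : ∀ a c₀ → a + c₀ + 3 ≡ a + (3 + c₀)
    regroup = solve-∀

  large : ∀ H → 𝒜 H ≡ true → 3 ≤ ∣ H ∣
  large H AH = ≤-trans (n≤1+n 3) (≤-trans 4≤a (≤-reflexive (sym (size H AH))))

  in-B : ∀ {k} → k ≤ 3 → k < ∣ B ∣
  in-B k≤3 = ≤-trans (s≤s k≤3) (≤-trans 4≤a (≤-reflexive (sym (size B AB))))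

  in-O : ∀ {k} → k ≤ 2 → k < ∣ O ∣
  in-O k≤2 = ≤-trans (s≤s k≤2) 3≤∣O∣

  contradiction : ⊥
  contradiction with pick B [] (in-B z≤n)
  ... | b₁ , B₁ , [] with pick B (b₁ ∷ []) (in-B (s≤s z≤n))
  ... | b₂ , B₂ , b₂≢b₁ ∷ [] with pick B (b₁ ∷ b₂ ∷ []) (in-B (s≤s (s≤s z≤n)))
  ... | b₃ , B₃ , b₃≢b₁ ∷ b₃≢b₂ ∷ [] with pick B (b₁ ∷ b₂ ∷ b₃ ∷ []) (in-B ≤-refl)
  ... | b₄ , B₄ , b₄≢b₁ ∷ b₄≢b₂ ∷ b₄≢b₃ ∷ [] with pick O [] (in-O z≤n)
  ... | p , Op , [] with pick O (p ∷ []) (in-O (s≤s z≤n))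
  ... | q , Oq , q≢p ∷ [] with pick O (p ∷ q ∷ []) (in-O ≤-refl)
  ... | y , Oy , y≢p ∷ y≢q ∷ [] =
    let (Bp , Dp) = outside⁻ Op ; (Bq , Dq) = outside⁻ Oq ; (By , Dy) = outside⁻ Oy
    in Avoiding.three-outside-impossible 𝒜 linear balanced AB {D} ∣D∣≡c₀ B∌D large B₁ B₂ B₃ B₄
         (≢-sym b₂≢b₁) (≢-sym b₃≢b₁) (≢-sym b₄≢b₁) (≢-sym b₃≢b₂) (≢-sym b₄≢b₂) (≢-sym b₄≢b₃)
         Bp Dp Bq Dq By Dy (≢-sym q≢p) y≢p y≢q

theorem9 : (n a b c : ℕ) → a > 0 → b > 0 → c > 0 → a + b + c ≡ n → a ≡ c + 2 →
    (m : ℕ) (S : Strategy n a m) →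
    Equitable S → InformativeForBob S b → Perfectly1Secure S b c →
    (a ≡ 3) × (c ≡ 1)
theorem9 n a b zero          _ _ () _ _ _ _ _ _ _
theorem9 n a b (suc zero)    _ _ _ _ a≡3 _ _ _ _ _ = a≡3 , refl
theorem9 n a b (suc (suc c₀)) 0<a 0<b _ a+b+c≡n a≡c+2 m S equitable informative secure =
  ⊥-elim (no-linear-balanced-family (ann i) (ann-size i) 4≤a room
            (informative⇒linear S a+b+c≡n a≡c+2 informative i)
            (secure⇒balanced S a+b+c≡n 0<a equitable secure {H} ∣H∣≡a i) H∈𝒜ᵢ)
  where
  open Strategy S
  4≤a : 4 ≤ a
  4≤a = subst (4 ≤_) (sym a≡c+2) (s≤s (s≤s (m≤n+m 2 c₀)))
  room : a + (3 + c₀) ≤ n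
  room = subst (a + (3 + c₀) ≤_) a+b+c≡n
           (subst (_≤ a + b + (2 + c₀)) (+-assoc a 1 (2 + c₀)) (+-monoˡ-≤ (2 + c₀) (+-monoʳ-≤ a 0<b)))
  a≤n : a ≤ ∣ ⊤ {n} ∣
  a≤n = subst (a ≤_) (trans a+b+c≡n (sym (∣⊤∣≡n n))) (≤-trans (m≤m+n a b) (m≤m+n (a + b) _))
  H : Subset n
  H = proj₁ (select ⊤ a a≤n)
  ∣H∣≡a : ∣ H ∣ ≡ a
  ∣H∣≡a = proj₁ (proj₂ (select ⊤ a a≤n))
  i : Fin m
  i = proj₁ (covers H ∣H∣≡a)
  H∈𝒜ᵢ : ann i H ≡ true
  H∈𝒜ᵢ = proj₂ (covers H ∣H∣≡a)
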